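{- Let $M$ be the sub-singleton monad on $\mathbf{Set}$. Let $\mathcal{A}$ be a set with a partial binary operation $c_f\cdot c_a$, and regard it as a monadic applicative structure over $M$ by setting $c_f\cdot_M c_a=\{c_r\}$ if $c_f\cdot c_a\downarrow c_r$ and $c_f\cdot_M c_a=\emptyset$ otherwise (this is a bijection between partial binary operations on $\mathcal{A}$ and maps $\mathcal{A}\times\mathcal{A}\to M\mathcal{A}$). Let $\langle\lambda^n.e\rangle\in\mathcal{A}$ be given for every $n\in\mathbb{N}$ and $e\in E_{n+1}(\mathcal{A})$. Then $(\mathcal{A},\cdot,\langle\lambda^{\bullet}.\,\cdot\,\rangle)$ is a partial combinatory algebra if and only if $(\mathcal{A},\cdot_M,\langle\lambda^{\bullet}.\,\cdot\,\rangle)$ is a monadic combinatory algebra over $M$. In this sense every PCA is a special case of an MCA.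
   Context: The sub-singleton monad: $MA=\{S\subseteq A\mid \forall x_1,x_2\in S.\ x_1=x_2\}$, $\eta_A(x)=\{x\}$, $\mu_A(m)=\bigcup_{X\in m}X$. For a set $\mathcal{A}$ of codes, expressions are $e::= i\in\mathbb{N}\mid c\in\mathcal{A}\mid e\bullet e$ (application $\bullet$ left associative), and $E_n(\mathcal{A})$ is the set of expressions all of whose variables $i$ satisfy $i<n$. Substitution $e[c_a]$: $0[c_a]=c_a$, $(i+1)[c_a]=i$, $c[c_a]=c$, $(e_1\bullet e_2)[c_a]=e_1[c_a]\bullet e_2[c_a]$. For a partial operation, evaluation of closed expressions is the relation $c\downarrow c$, and $e_f\bullet e_a\downarrow c_r$ whenever $e_f\downarrow c_f$, $e_a\downarrow c_a$, $c_f\cdot c_a\downarrow c_r$. A PCA is a set with a partial binary operation and codes $\langle\lambda^n.e\rangle$ for $e\in E_{n+1}(\mathcal{A})$ such that for all $n$, $e\in E_{n+2}(\mathcal{A})$, $c_a$: $\langle\lambda^{n+1}.e\rangle\cdot c_a\downarrow\langle\lambda^n.e[c_a]\rangle$, and for $e\in E_1(\mathcal{A})$: $\langle\lambda^0.e\rangle\cdot c_a\downarrow c_r\iff e[c_a]\downarrow c_r$. For a monad $(M,\eta,\mu)$ on $\mathbf{Set}$, a monadic applicative structure (MAS) is a set $\mathcal{A}$ with a map $\cdot:\mathcal{A}\times\mathcal{A}\to M\mathcal{A}$; writing $\mathrm{let}\ x\Leftarrow m\ \mathrm{in}\ g(x):=\mu(Mg(m))$, the call-by-value evaluation $\nu:E_0(\mathcal{A})\to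 M\mathcal{A}$ is $\nu(c)=\eta(c)$, $\nu(e_f\bullet e_a)=\mathrm{let}\ c_f\Leftarrow\nu(e_f)\ \mathrm{in}\ \mathrm{let}\ c_a\Leftarrow\nu(e_a)\ \mathrm{in}\ c_f\cdot c_a$. An MCA is an MAS with a code $\langle\lambda^n.e\rangle\in\mathcal{A}$ for each $n$ and $e\in E_{n+1}(\mathcal{A})$ such that $\langle\lambda^{n+1}.e\rangle\cdot c=\eta(\langle\lambda^n.e[c]\rangle)$ for all $e\in E_{n+2}(\mathcal{A})$, $c\in\mathcal{A}$, and $\langle\lambda^0.e\rangle\cdot c=\nu(e[c])$ for all $e\in E_1(\mathcal{A})$, $c\in\mathcal{A}$. -}

module Defs where

open import Data.Nat using (ℕ; zero; suc)
open import Data.Fin using (Fin; zero; suc)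
open import Data.Product using (Σ; _×_; _,_; proj₁; proj₂)
open import Relation.Binary.PropositionalEquality using (_≡_; refl; sym; trans; subst)
open import Function.Bundles using (_⇔_)

record M (A : Set) : Set₁ where
  field
    _∋_    : A → Set
    unique : ∀ {x y} → _∋_ x → _∋_ y → x ≡ y
open M public

_≈M_ : {A : Set} → M A → M A → Set
S ≈M T = ∀ x → (S ∋ x) ⇔ (T ∋ x)

η : {A : Set} → A → M A
η x = record { _∋_ = λ y → x ≡ y ; unique = λ p q → trans (sym p) q }

-- let x ⇐ m in g(x) := μ (M g m) = ⋃ { g x | x ∈ m },
-- i.e.  y ∈ (let x ⇐ m in g x)  iff  ∃ x ∈ m. y ∈ g x.
bindM : {A B : Set} → M A → (A → M B) → M B
bindM {A} {B} m g = record { _∋_ = P ; unique = u }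
  where
  P : B → Set
  P y = Σ A (λ x → (m ∋ x) × (g x ∋ y))
  u : ∀ {y y'} → P y → P y' → y ≡ y'
  u (x , mx , gy) (x' , mx' , gy') with unique m mx mx'
  ... | refl = unique (g x) gy gy'

infixl 5 _∙_
data Exp (A : Set) (n : ℕ) : Set where
  var  : Fin n → Exp A n
  code : A → Exp A n
  _∙_  : Exp A n → Exp A n → Exp A n

_[_] : {A : Set} {n : ℕ} → Exp A (suc n) → A → Exp A n
var zero    [ c ] = code c
var (suc i) [ c ] = var i
code c'     [ c ] = code c'
(e₁ ∙ e₂)   [ c ] = (e₁ [ c ]) ∙ (e₂ [ c ])

record PartialOp (A : Set) : Set₁ where
  field
    _·_↓_      : A → A → A → Set
    functional : ∀ {f a r r'} → _·_↓_ f a r → _·_↓_ f a r' → r ≡ r'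
open PartialOp public

data Eval {A : Set} (op : PartialOp A) : Exp A 0 → A → Set where
  ev-code : ∀ c → Eval op (code c) c
  ev-app  : ∀ {ef ea cf ca cr} → Eval op ef cf → Eval op ea ca →
            (op · cf ↓ ca) cr → Eval op (ef ∙ ea) cr

Lambdas : Set → Set
Lambdas A = (n : ℕ) → Exp A (suc n) → A

IsPCA : {A : Set} → PartialOp A → Lambdas A → Set
IsPCA {A} op lam =
  ((n : ℕ) (e : Exp A (suc (suc n))) (c : A) →
     (op · lam (suc n) e ↓ c) (lam n (e [ c ])))
  × ((e : Exp A 1) (c r : A) →
     ((op · lam 0 e ↓ c) r) ⇔ Eval op (e [ c ]) r)

MAS : Set → Set₁
MAS A = A → A → M A

ν : {A : Set} → MAS A → Exp A 0 → M A
ν app (var ())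
ν app (code c) = η c
ν app (ef ∙ ea) = bindM (ν app ef) (λ cf → bindM (ν app ea) (λ ca → app cf ca))

IsMCA : {A : Set} → MAS A → Lambdas A → Set
IsMCA {A} app lam =
  ((n : ℕ) (e : Exp A (suc (suc n))) (c : A) →
     app (lam (suc n) e) c ≈M η (lam n (e [ c ])))
  × ((e : Exp A 1) (c : A) →
     app (lam 0 e) c ≈M ν app (e [ c ]))

toMAS : {A : Set} → PartialOp A → MAS A
toMAS op f a = record { _∋_ = λ r → (op · f ↓ a) r ; unique = functional op }

{-# OPTIONS --safe #-}
module Submission where

open import Defs
open import Function.Bundles using (_⇔_; mk⇔; Equivalence)
open import Function.Construct.Identity using (⇔-id)
open import Function.Related.Propositional using (equivalence)
open import Function.Related.TypeIsomorphisms using (Related-cong)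
open import Data.Nat using (suc)
open import Data.Product using (_,_)
open import Data.Product.Function.NonDependent.Propositional using (_×-⇔_)
open import Relation.Binary.PropositionalEquality using (refl)

-- Both directions of the theorem are pointwise: a sub-singleton equals {r}
-- exactly when it contains r, and ν over the induced MAS contains r exactly
-- when the expression evaluates to r.

Π-cong-⇔ : {I : Set} {P Q : I → Set} →
           (∀ i → P i ⇔ Q i) → (∀ i → P i) ⇔ (∀ i → Q i)
Π-cong-⇔ P⇔Q = mk⇔ (λ p i → Equivalence.to (P⇔Q i) (p i))
                   (λ q i → Equivalence.from (P⇔Q i) (q i))

∋⇔≈M-η : {A : Set} (S : M A) (r : A) → S ∋ r ⇔ S ≈M η r
∋⇔≈M-η S r = mk⇔ (λ r∈S x → mk⇔ (unique S r∈S) (λ { refl → r∈S }))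
                 (λ S≈ηr → Equivalence.from (S≈ηr r) refl)

module _ {A : Set} (op : PartialOp A) where

  Eval⇒ν∋ : ∀ {e r} → Eval op e r → ν (toMAS op) e ∋ r
  Eval⇒ν∋ (ev-code c) = refl
  Eval⇒ν∋ (ev-app {cf = cf} {ca = ca} ef↓cf ea↓ca cf·ca↓r) =
    cf , Eval⇒ν∋ ef↓cf , ca , Eval⇒ν∋ ea↓ca , cf·ca↓r

  ν∋⇒Eval : ∀ e {r} → ν (toMAS op) e ∋ r → Eval op e r
  ν∋⇒Eval (code c)  refl = ev-code c
  ν∋⇒Eval (ef ∙ ea) (cf , cf∈νef , ca , ca∈νea , cf·ca↓r) =
    ev-app (ν∋⇒Eval ef cf∈νef) (ν∋⇒Eval ea ca∈νea) cf·ca↓r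

  Eval⇔ν∋ : ∀ e r → Eval op e r ⇔ ν (toMAS op) e ∋ r
  Eval⇔ν∋ e r = mk⇔ Eval⇒ν∋ (ν∋⇒Eval e)

proposition1 : {A : Set} (op : PartialOp A) (lam : Lambdas A) →
    IsPCA op lam ⇔ IsMCA (toMAS op) lam
proposition1 op lam =
  (Π-cong-⇔ λ n → Π-cong-⇔ λ e → Π-cong-⇔ λ c →
     ∋⇔≈M-η (toMAS op (lam (suc n) e) c) _)
  ×-⇔
  (Π-cong-⇔ λ e → Π-cong-⇔ λ c → Π-cong-⇔ λ r →
     Related-cong {k = equivalence} (⇔-id _) (Eval⇔ν∋ op (e [ c ]) r))
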